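{- Consider a sequence of networks $G_0, G_1, G_2, \dots$, where $G_0$ is the empty network (no nodes) and, at each step $k \ge 1$, exactly two new nodes arrive, so $N_k = N_{k-1} + 2 = 2k$. The nodes are maintained in two halves $A$ and $B$, and the nodes of each half are ordered by arrival time (the "first" node of a half is the earliest arrived one). At step $k$: (i) one new node $a_k$ is added to $A$ and the other new node $b_k$ is added to $B$; (ii) $a_k$ is linked to all other nodes of $A$ and $b_k$ is linked to all other nodes of $B$; (iii) $a_k$ and $b_k$ are linked to each other; (iv) $a_k$ is linked to the first node of $B$ and $b_k$ is linked to the first node of $A$ (if not already linked); no links are removed. Then $G_i$ is a subnetwork of $G_j$ for all $i \le j$, and for every $k \ge 1$ the network $G_k$ is $N_k/2$-robust and its number of links $L_k$ satisfies $L_k \le \frac{N_k^2}{4} + N_k - 2$.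
   Context: A network is a finite simple undirected graph; links are edges. For an integer $N_f$, a network $G$ is $N_f$-robust if for every set $S$ of $N_f$ nodes of $G$, the network obtained by deleting the nodes of $S$ and their incident links is connected (a network with a single node counts as connected). -}

module Defs where

open import Data.Nat using (ℕ; zero; suc; _+_; _<_)
open import Data.Bool using (Bool; true; false; _∨_; _∧_; if_then_else_)
open import Data.Fin using (Fin; zero; suc; _↑ˡ_; _↑ʳ_; splitAt; toℕ; _≟_; _<?_)
open import Data.Fin.Subset using (Subset; _∉_)
open import Data.Sum using (_⊎_; inj₁; inj₂)
open import Data.List using (List; []; _∷_; _++_; [_]; map; allFin)
open import Data.Bool.ListAction using (any)
open import Data.Nat.ListAction using (sum)
open import Data.Maybe using (Maybe; just; nothing)
open import Relation.Nullary.Decidable using (⌊_⌋)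
open import Relation.Binary.PropositionalEquality using (_≡_)

-- A network: nodes Fin size, a (symmetric, irreflexive) Boolean adjacency,
-- and the two halves A and B, each listed in order of arrival
-- (the head of the list is the earliest arrived node of that half).
record Net : Set where
  field
    size : ℕ
    adj  : Fin size → Fin size → Bool
    A    : List (Fin size)
    B    : List (Fin size)
open Net public

_∈ᵇ_ : ∀ {n} → Fin n → List (Fin n) → Bool
x ∈ᵇ L = any (λ y → ⌊ x ≟ y ⌋) L

isFirst : ∀ {n} → Fin n → List (Fin n) → Bool
isFirst x [] = false
isFirst x (y ∷ _) = ⌊ x ≟ y ⌋

empty : Net
empty = record { size = 0 ; adj = λ () ; A = [] ; B = [] }

-- One step of the construction.  Old nodes x ↦ x ↑ˡ 2 ; new nodes
-- a_k = n ↑ʳ 0 (joins A) and b_k = n ↑ʳ 1 (joins B).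
step : Net → Net
step G = record
  { size = n + 2
  ; adj  = λ u v → edge (splitAt n u) (splitAt n v)
  ; A    = map (_↑ˡ 2) (A G) ++ [ n ↑ʳ zero ]
  ; B    = map (_↑ˡ 2) (B G) ++ [ n ↑ʳ suc zero ]
  }
  where
  n : ℕ
  n = size G
  newEdge : Fin 2 → Fin n → Bool
  newEdge zero x = (x ∈ᵇ A G) ∨ isFirst x (B G)
  newEdge (suc zero) x = (x ∈ᵇ B G) ∨ isFirst x (A G)
  edge : Fin n ⊎ Fin 2 → Fin n ⊎ Fin 2 → Bool
  edge (inj₁ x) (inj₁ y) = adj G x y
  edge (inj₁ x) (inj₂ j) = newEdge j x
  edge (inj₂ j) (inj₁ x) = newEdge j x
  edge (inj₂ zero) (inj₂ zero) = false
  edge (inj₂ zero) (inj₂ (suc zero)) = true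
  edge (inj₂ (suc zero)) (inj₂ zero) = true
  edge (inj₂ (suc zero)) (inj₂ (suc zero)) = false

G : ℕ → Net
G zero = empty
G (suc k) = step (G k)

N : ℕ → ℕ
N k = size (G k)

links : Net → ℕ
links H = sum (map (λ u → sum (map (λ v → if adj H u v ∧ ⌊ u <? v ⌋ then 1 else 0)
                                   (allFin (size H))))
                   (allFin (size H)))

L : ℕ → ℕ
L k = links (G k)

-- v is reachable from u in the network H with the nodes of S deleted
-- (u itself is assumed to lie outside S; every later node is outside S)
data Reach (H : Net) (S : Subset (size H)) : Fin (size H) → Fin (size H) → Set where
  here  : ∀ {u} → Reach H S u u
  there : ∀ {u w v} → adj H u w ≡ true → w ∉ S → Reach H S w v → Reach H S u v

ConnectedWithout : (H : Net) → Subset (size H) → Set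
ConnectedWithout H S = ∀ u v → u ∉ S → v ∉ S → Reach H S u v

Robust : Net → ℕ → Set
Robust H f = (S : Subset (size H)) → Data.Fin.Subset.∣ S ∣ ≡ f → ConnectedWithout H S

{-# OPTIONS --safe #-}
-- Number the nodes by arrival, so that a_i is node 2i-2 and b_i is node 2i-1. Then in every G_k
-- two distinct nodes m and n are linked exactly when they lie in the same half (m ≡ n mod 2),
-- arrived together (⌊m/2⌋ = ⌊n/2⌋), or one of them is a first node (m ≤ 1 or n ≤ 1); with this
-- closed form G_i ⊆ G_j is immediate. Delete k of the 2k nodes. A surviving first node is linked
-- to every node. If both first nodes are deleted, only k-2 deletions are left for the other k-1
-- arrival pairs, so some pair survives entirely, and any survivor reaches any other through it
-- (same half, same pair, same half). Finally a_i has at most i and b_i at most i+1 links to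
-- earlier nodes (i ≥ 2), so L_k ≤ 1 + Σ_{i=2}^{k} (2i+1) = k² + 2k - 2 = N_k²/4 + N_k - 2.
module Submission where

open import Defs
open import Data.Bool using (Bool; true; false; not; _∧_; _∨_; if_then_else_)
open import Data.Bool.Properties using (∨-assoc; ∨-comm; ∨-identityʳ; ∨-zeroʳ; ∧-zeroʳ)
open import Data.Bool.ListAction using (any)
open import Data.Empty using (⊥-elim)
open import Data.Fin using (Fin; zero; suc; toℕ; _↑ˡ_; _↑ʳ_; _≟_; _<?_; inject≤; fromℕ<; opposite)
open import Data.Fin.Properties
  using (toℕ-↑ˡ; toℕ-↑ʳ; toℕ<n; toℕ-inject≤; toℕ-fromℕ<; toℕ-injective; splitAt-↑ˡ; splitAt-↑ʳ; ↑ˡ-injective; ↑ʳ-injective; suc-injective)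
open import Data.Fin.Subset using (Subset; _∉_; ∣_∣)
open import Data.List using (List; []; _∷_; _++_; [_]; map; allFin; tabulate)
open import Data.List.Properties using (map-tabulate)
open import Data.Nat using (ℕ; zero; suc; _+_; _*_; _∸_; _≤_; _<_; z≤n; s≤s; s≤s⁻¹; z<s; _≡ᵇ_; _≤ᵇ_; _<ᵇ_; ⌊_/2⌋)
import Data.Nat.Properties as ℕ
open import Data.Nat.DivMod using (_/_; m*n/n≡m)
open import Data.Nat.ListAction using (sum)
open import Data.Nat.Tactic.RingSolver using (solve-∀)
open import Data.Product using (Σ; Σ-syntax; ∃-syntax; _×_; _,_)
open import Data.Sum using (_⊎_; inj₁; inj₂)
open import Data.Vec using ([]; _∷_; here; there)
open import Function using (_∘_)
open import Relation.Binary.Definitions using (DecidableEquality)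
open import Relation.Nullary using (yes; no)
open import Relation.Nullary.Decidable using (⌊_⌋; isYes≗does; dec-true; dec-false)
open import Relation.Binary.PropositionalEquality hiding ([_])

⌊≟⌋-injective : ∀ {A B : Set} (_≟ᴬ_ : DecidableEquality A) (_≟ᴮ_ : DecidableEquality B) {f : A → B} →
                (∀ {x y} → f x ≡ f y → x ≡ y) → ∀ x y → ⌊ f x ≟ᴮ f y ⌋ ≡ ⌊ x ≟ᴬ y ⌋
⌊≟⌋-injective _≟ᴬ_ _≟ᴮ_ {f} inj x y with x ≟ᴬ y | f x ≟ᴮ f y
... | yes _ | yes _ = refl
... | no _ | no _ = refl
... | yes x≡y | no fx≢fy = ⊥-elim (fx≢fy (cong f x≡y))
... | no x≢y | yes fx≡fy = ⊥-elim (x≢y (inj fx≡fy))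

⌊≟⌋-sym : ∀ {A : Set} (_≟ᴬ_ : DecidableEquality A) x y → ⌊ x ≟ᴬ y ⌋ ≡ ⌊ y ≟ᴬ x ⌋
⌊≟⌋-sym _≟ᴬ_ x y with x ≟ᴬ y | y ≟ᴬ x
... | yes _ | yes _ = refl
... | no _ | no _ = refl
... | yes x≡y | no y≢x = ⊥-elim (y≢x (sym x≡y))
... | no x≢y | yes y≡x = ⊥-elim (x≢y (sym y≡x))

⌊≟⌋-≢ : ∀ {A : Set} (_≟ᴬ_ : DecidableEquality A) {x y} → x ≢ y → ⌊ x ≟ᴬ y ⌋ ≡ false
⌊≟⌋-≢ _≟ᴬ_ {x} {y} x≢y = trans (isYes≗does (x ≟ᴬ y)) (dec-false (x ≟ᴬ y) x≢y)

⌊≟⌋-refl : ∀ {A : Set} (_≟ᴬ_ : DecidableEquality A) x → ⌊ x ≟ᴬ x ⌋ ≡ true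
⌊≟⌋-refl _≟ᴬ_ x = trans (isYes≗does (x ≟ᴬ x)) (dec-true (x ≟ᴬ x) refl)

≡ᵇ-refl : ∀ n → (n ≡ᵇ n) ≡ true
≡ᵇ-refl n = dec-true (n ℕ.≟ n) refl

≡ᵇ-≢ : ∀ {m n} → m ≢ n → (m ≡ᵇ n) ≡ false
≡ᵇ-≢ {m} {n} = dec-false (m ℕ.≟ n)

≡ᵇ-sym : ∀ m n → (m ≡ᵇ n) ≡ (n ≡ᵇ m)
≡ᵇ-sym m n = trans (sym (isYes≗does (m ℕ.≟ n))) (trans (⌊≟⌋-sym ℕ._≟_ m n) (isYes≗does (n ℕ.≟ m)))

⌊≟⌋-toℕ : ∀ {n} (x y : Fin n) → ⌊ x ≟ y ⌋ ≡ (toℕ x ≡ᵇ toℕ y)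
⌊≟⌋-toℕ x y = trans (sym (⌊≟⌋-injective _≟_ ℕ._≟_ toℕ-injective x y)) (isYes≗does (toℕ x ℕ.≟ toℕ y))

↑ˡ≢↑ʳ : ∀ {m n} (x : Fin n) (y : Fin m) → x ↑ˡ m ≢ n ↑ʳ y
↑ˡ≢↑ʳ {n = suc n} zero y ()
↑ˡ≢↑ʳ {n = suc n} (suc x) y eq = ↑ˡ≢↑ʳ x y (suc-injective eq)

any-++ : ∀ {X : Set} (p : X → Bool) xs ys → any p (xs ++ ys) ≡ any p xs ∨ any p ys
any-++ p [] ys = refl
any-++ p (x ∷ xs) ys = trans (cong (p x ∨_) (any-++ p xs ys)) (sym (∨-assoc (p x) _ _))

any-map : ∀ {X Y : Set} {p : Y → Bool} {q : X → Bool} {f : X → Y} → (∀ x → p (f x) ≡ q x) → ∀ xs → any p (map f xs) ≡ any q xs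
any-map p∘f≗q [] = refl
any-map p∘f≗q (x ∷ xs) = cong₂ _∨_ (p∘f≗q x) (any-map p∘f≗q xs)

any-false : ∀ {X : Set} (xs : List X) → any (λ _ → false) xs ≡ false
any-false [] = refl
any-false (x ∷ xs) = any-false xs

∑< : ℕ → (ℕ → ℕ) → ℕ
∑< zero f = 0
∑< (suc n) f = f 0 + ∑< n (f ∘ suc)

syntax ∑< n (λ m → e) = ∑[ m < n ] e

∑-snoc : ∀ n (f : ℕ → ℕ) → ∑[ m < suc n ] f m ≡ ∑[ m < n ] f m + f n
∑-snoc zero f = ℕ.+-comm (f 0) 0
∑-snoc (suc n) f = trans (cong (f 0 +_) (∑-snoc n (λ m → f (suc m)))) (sym (ℕ.+-assoc (f 0) _ _))

∑-cong : ∀ n {f g : ℕ → ℕ} → (∀ m → f m ≡ g m) → ∑[ m < n ] f m ≡ ∑[ m < n ] g m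
∑-cong zero f≗g = refl
∑-cong (suc n) f≗g = cong₂ _+_ (f≗g 0) (∑-cong n (λ m → f≗g (suc m)))

∑-mono-≤ : ∀ n {f g : ℕ → ℕ} → (∀ m → m < n → f m ≤ g m) → ∑[ m < n ] f m ≤ ∑[ m < n ] g m
∑-mono-≤ zero f≤g = z≤n
∑-mono-≤ (suc n) f≤g = ℕ.+-mono-≤ (f≤g 0 z<s) (∑-mono-≤ n (λ m m<n → f≤g (suc m) (s≤s m<n)))

∑-+ : ∀ n (f g : ℕ → ℕ) → ∑[ m < n ] (f m + g m) ≡ ∑[ m < n ] f m + ∑[ m < n ] g m
∑-+ zero f g = refl
∑-+ (suc n) f g = trans (cong (f 0 + g 0 +_) (∑-+ n (λ m → f (suc m)) (λ m → g (suc m)))) (interchange (f 0) (g 0) _ _)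
  where
  interchange : ∀ a b c d → (a + b) + (c + d) ≡ (a + c) + (b + d)
  interchange = solve-∀

∑-zero : ∀ n {f : ℕ → ℕ} → (∀ m → m < n → f m ≡ 0) → ∑[ m < n ] f m ≡ 0
∑-zero zero f≡0 = refl
∑-zero (suc n) f≡0 = cong₂ _+_ (f≡0 0 z<s) (∑-zero n (λ m m<n → f≡0 (suc m) (s≤s m<n)))

sum-tabulate : ∀ {n} (h : Fin n → ℕ) (g : ℕ → ℕ) → (∀ x → h x ≡ g (toℕ x)) → sum (tabulate h) ≡ ∑[ m < n ] g m
sum-tabulate {zero} h g h≗g = refl
sum-tabulate {suc n} h g h≗g = cong₂ _+_ (h≗g zero) (sum-tabulate (λ x → h (suc x)) (λ m → g (suc m)) (λ x → h≗g (suc x)))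

sum-allFin : ∀ {n} (h : Fin n → ℕ) (g : ℕ → ℕ) → (∀ x → h x ≡ g (toℕ x)) → sum (map h (allFin n)) ≡ ∑[ m < n ] g m
sum-allFin h g h≗g = trans (cong sum (map-tabulate (λ x → x) h)) (sum-tabulate h g h≗g)

oneIf : Bool → ℕ
oneIf b = if b then 1 else 0

oneIf-∨ : ∀ a b → oneIf (a ∨ b) ≤ oneIf a + oneIf b
oneIf-∨ true b = s≤s z≤n
oneIf-∨ false b = ℕ.≤-refl

oneIf-∧ : ∀ a b → oneIf (a ∧ b) ≤ oneIf a
oneIf-∧ true true = ℕ.≤-refl
oneIf-∧ true false = z≤n
oneIf-∧ false b = z≤n

oneIf≤1 : ∀ b → oneIf b ≤ 1
oneIf≤1 true = ℕ.≤-refl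
oneIf≤1 false = z≤n

-- Closed form of the adjacency

double : ℕ → ℕ
double zero = 0
double (suc k) = suc (suc (double k))

double≡2* : ∀ k → double k ≡ 2 * k
double≡2* zero = refl
double≡2* (suc k) = cong suc (trans (cong suc (double≡2* k)) (sym (ℕ.+-suc k (k + 0))))

sideOf : ℕ → Fin 2
sideOf zero = zero
sideOf (suc zero) = suc zero
sideOf (suc (suc m)) = sideOf m

-- pairNode i zero is a_(i+1) and pairNode i (suc zero) is b_(i+1).
pairNode : ℕ → Fin 2 → ℕ
pairNode i c = toℕ c + double i

sideOf-pairNode : ∀ i c → sideOf (pairNode i c) ≡ c
sideOf-pairNode zero zero = refl
sideOf-pairNode zero (suc zero) = refl
sideOf-pairNode (suc i) zero = sideOf-pairNode i zero
sideOf-pairNode (suc i) (suc zero) = sideOf-pairNode i (suc zero)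

⌊pairNode/2⌋ : ∀ i c → ⌊ pairNode i c /2⌋ ≡ i
⌊pairNode/2⌋ zero zero = refl
⌊pairNode/2⌋ zero (suc zero) = refl
⌊pairNode/2⌋ (suc i) zero = cong suc (⌊pairNode/2⌋ i zero)
⌊pairNode/2⌋ (suc i) (suc zero) = cong suc (⌊pairNode/2⌋ i (suc zero))

pairNode-injective : ∀ i {c d} → pairNode i c ≡ pairNode i d → c ≡ d
pairNode-injective i {c} {d} eq = trans (sym (sideOf-pairNode i c)) (trans (cong sideOf eq) (sideOf-pairNode i d))

pairNode-< : ∀ {i k} c → i < k → pairNode i c < double k
pairNode-< {zero} {suc k} zero _ = s≤s z≤n
pairNode-< {zero} {suc k} (suc zero) _ = s≤s (s≤s z≤n)
pairNode-< {suc i} {suc k} zero (s≤s i<k) = s≤s (s≤s (pairNode-< zero i<k))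
pairNode-< {suc i} {suc k} (suc zero) (s≤s i<k) = s≤s (s≤s (pairNode-< (suc zero) i<k))

⌊/2⌋-< : ∀ {m} k → m < double k → ⌊ m /2⌋ < k
⌊/2⌋-< {zero} (suc k) _ = z<s
⌊/2⌋-< {suc zero} (suc k) _ = z<s
⌊/2⌋-< {suc (suc m)} (suc k) (s≤s (s≤s m<2k)) = s≤s (⌊/2⌋-< k m<2k)

linkable : ℕ → ℕ → Bool
linkable m n = ⌊ sideOf m ≟ sideOf n ⌋ ∨ (⌊ m /2⌋ ≡ᵇ ⌊ n /2⌋) ∨ (m ≤ᵇ 1) ∨ (n ≤ᵇ 1)

linked : ℕ → ℕ → Bool
linked m n = not (m ≡ᵇ n) ∧ linkable m n

linkable-sym : ∀ m n → linkable m n ≡ linkable n m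
linkable-sym m n = begin
  ⌊ sideOf m ≟ sideOf n ⌋ ∨ (⌊ m /2⌋ ≡ᵇ ⌊ n /2⌋) ∨ (m ≤ᵇ 1) ∨ (n ≤ᵇ 1)
    ≡⟨ cong₂ _∨_ (⌊≟⌋-sym _≟_ (sideOf m) (sideOf n))
                 (cong₂ _∨_ (≡ᵇ-sym ⌊ m /2⌋ ⌊ n /2⌋) (∨-comm (m ≤ᵇ 1) (n ≤ᵇ 1))) ⟩
  ⌊ sideOf n ≟ sideOf m ⌋ ∨ (⌊ n /2⌋ ≡ᵇ ⌊ m /2⌋) ∨ (n ≤ᵇ 1) ∨ (m ≤ᵇ 1) ∎
  where open ≡-Reasoning

linked-sym : ∀ m n → linked m n ≡ linked n m
linked-sym m n = cong₂ (λ e l → not e ∧ l) (≡ᵇ-sym m n) (linkable-sym m n)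

linked-irrefl : ∀ n → linked n n ≡ false
linked-irrefl n rewrite ≡ᵇ-refl n = refl

linkable-sameSide : ∀ {m n} → sideOf m ≡ sideOf n → linkable m n ≡ true
linkable-sameSide {m} {n} eq rewrite eq | ⌊≟⌋-refl _≟_ (sideOf n) = refl

linkable-samePair : ∀ {m n} → ⌊ m /2⌋ ≡ ⌊ n /2⌋ → linkable m n ≡ true
linkable-samePair {m} {n} eq rewrite eq | ≡ᵇ-refl ⌊ n /2⌋ = ∨-zeroʳ _

<2⇒≤ᵇ1 : ∀ {m} → m < 2 → (m ≤ᵇ 1) ≡ true
<2⇒≤ᵇ1 {zero} _ = refl
<2⇒≤ᵇ1 {suc zero} _ = refl
<2⇒≤ᵇ1 {suc (suc m)} (s≤s (s≤s ()))

linkable-firstˡ : ∀ {m} n → m < 2 → linkable m n ≡ true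
linkable-firstˡ {m} n m<2 rewrite <2⇒≤ᵇ1 m<2 = trans (cong (side ∨_) (∨-zeroʳ pair)) (∨-zeroʳ side)
  where
  side = ⌊ sideOf m ≟ sideOf n ⌋
  pair = ⌊ m /2⌋ ≡ᵇ ⌊ n /2⌋

linkable-firstʳ : ∀ m {n} → n < 2 → linkable m n ≡ true
linkable-firstʳ m {n} n<2 = trans (linkable-sym m n) (linkable-firstˡ m n<2)

-- Next to a same-half link, the condition m ≤ 1 only adds the first node of the other half.
side-or-first : ∀ m c → ⌊ sideOf m ≟ c ⌋ ∨ (m ≤ᵇ 1) ∨ false ≡ ⌊ sideOf m ≟ c ⌋ ∨ (m ≡ᵇ toℕ (opposite c))
side-or-first zero zero = refl
side-or-first zero (suc zero) = refl
side-or-first (suc zero) zero = refl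
side-or-first (suc zero) (suc zero) = refl
side-or-first (suc (suc m)) zero = refl
side-or-first (suc (suc m)) (suc zero) = refl

pairNode-≰ᵇ1 : ∀ k c → (pairNode (suc k) c ≤ᵇ 1) ≡ false
pairNode-≰ᵇ1 k zero = refl
pairNode-≰ᵇ1 k (suc zero) = refl

linked-to-pairNode : ∀ {m k} c → m < double k → linked m (pairNode k c) ≡ ⌊ sideOf m ≟ c ⌋ ∨ (m ≡ᵇ toℕ (opposite c))
linked-to-pairNode {m} {suc k} c m<2k
  rewrite ≡ᵇ-≢ (ℕ.<⇒≢ (ℕ.<-≤-trans m<2k (ℕ.m≤n+m _ (toℕ c))))
        | sideOf-pairNode (suc k) c | ⌊pairNode/2⌋ (suc k) c | ≡ᵇ-≢ (ℕ.<⇒≢ (⌊/2⌋-< (suc k) m<2k))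
        | pairNode-≰ᵇ1 k c = side-or-first m c

linked-within-pair : ∀ k c d → linked (pairNode k c) (pairNode k d) ≡ not ⌊ c ≟ d ⌋
linked-within-pair k c d with c ≟ d
... | yes refl = linked-irrefl (pairNode k c)
... | no c≢d = cong₂ (λ e l → not e ∧ l) (≡ᵇ-≢ (c≢d ∘ pairNode-injective k))
                 (linkable-samePair (trans (⌊pairNode/2⌋ k c) (sym (⌊pairNode/2⌋ k d))))

-- The construction step

data OldOrNew (n : ℕ) : Fin (n + 2) → Set where
  old : (x : Fin n) → OldOrNew n (x ↑ˡ 2)
  new : (c : Fin 2) → OldOrNew n (n ↑ʳ c)

oldOrNew : ∀ n (x : Fin (n + 2)) → OldOrNew n x
oldOrNew zero x = new x
oldOrNew (suc n) zero = old zero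
oldOrNew (suc n) (suc x) with oldOrNew n x
... | old y = old (suc y)
... | new c = new c

half : Fin 2 → (H : Net) → List (Fin (size H))
half zero H = A H
half (suc zero) H = B H

extend : ∀ {n} → List (Fin n) → Fin 2 → List (Fin (n + 2))
extend {n} L c = map (_↑ˡ 2) L ++ [ n ↑ʳ c ]

half-step : ∀ c H → half c (step H) ≡ extend (half c H) c
half-step zero H = refl
half-step (suc zero) H = refl

module _ (H : Net) where

  private
    n = size H

  adj-step-old : ∀ x y → adj (step H) (x ↑ˡ 2) (y ↑ˡ 2) ≡ adj H x y
  adj-step-old x y rewrite splitAt-↑ˡ n x 2 | splitAt-↑ˡ n y 2 = refl

  adj-step-old-new : ∀ x c → adj (step H) (x ↑ˡ 2) (n ↑ʳ c) ≡ x ∈ᵇ half c H ∨ isFirst x (half (opposite c) H)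
  adj-step-old-new x zero rewrite splitAt-↑ˡ n x 2 | splitAt-↑ʳ n 2 zero = refl
  adj-step-old-new x (suc zero) rewrite splitAt-↑ˡ n x 2 | splitAt-↑ʳ n 2 (suc zero) = refl

  adj-step-new-old : ∀ c x → adj (step H) (n ↑ʳ c) (x ↑ˡ 2) ≡ x ∈ᵇ half c H ∨ isFirst x (half (opposite c) H)
  adj-step-new-old zero x rewrite splitAt-↑ˡ n x 2 | splitAt-↑ʳ n 2 zero = refl
  adj-step-new-old (suc zero) x rewrite splitAt-↑ˡ n x 2 | splitAt-↑ʳ n 2 (suc zero) = refl

  adj-step-new : ∀ c d → adj (step H) (n ↑ʳ c) (n ↑ʳ d) ≡ not ⌊ c ≟ d ⌋
  adj-step-new zero zero rewrite splitAt-↑ʳ n 2 zero = refl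
  adj-step-new zero (suc zero) rewrite splitAt-↑ʳ n 2 zero | splitAt-↑ʳ n 2 (suc zero) = refl
  adj-step-new (suc zero) zero rewrite splitAt-↑ʳ n 2 zero | splitAt-↑ʳ n 2 (suc zero) = refl
  adj-step-new (suc zero) (suc zero) rewrite splitAt-↑ʳ n 2 (suc zero) = refl

∈ᵇ-extend-old : ∀ {n} (x : Fin n) L c → (x ↑ˡ 2) ∈ᵇ extend L c ≡ x ∈ᵇ L
∈ᵇ-extend-old {n} x L c = begin
  any (λ y → ⌊ x ↑ˡ 2 ≟ y ⌋) (map (_↑ˡ 2) L ++ [ n ↑ʳ c ])
    ≡⟨ any-++ _ (map (_↑ˡ 2) L) [ n ↑ʳ c ] ⟩
  any (λ y → ⌊ x ↑ˡ 2 ≟ y ⌋) (map (_↑ˡ 2) L) ∨ ⌊ x ↑ˡ 2 ≟ n ↑ʳ c ⌋ ∨ false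
    ≡⟨ cong₂ _∨_ (any-map (⌊≟⌋-injective _≟_ _≟_ (↑ˡ-injective 2 _ _) x) L)
                 (cong (_∨ false) (⌊≟⌋-≢ _≟_ (↑ˡ≢↑ʳ x c))) ⟩
  x ∈ᵇ L ∨ false
    ≡⟨ ∨-identityʳ _ ⟩
  x ∈ᵇ L ∎
  where open ≡-Reasoning

∈ᵇ-extend-new : ∀ {n} (L : List (Fin n)) d c → (n ↑ʳ d) ∈ᵇ extend L c ≡ ⌊ d ≟ c ⌋
∈ᵇ-extend-new {n} L d c = begin
  any (λ y → ⌊ n ↑ʳ d ≟ y ⌋) (map (_↑ˡ 2) L ++ [ n ↑ʳ c ])
    ≡⟨ any-++ _ (map (_↑ˡ 2) L) [ n ↑ʳ c ] ⟩
  any (λ y → ⌊ n ↑ʳ d ≟ y ⌋) (map (_↑ˡ 2) L) ∨ ⌊ n ↑ʳ d ≟ n ↑ʳ c ⌋ ∨ false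
    ≡⟨ cong₂ _∨_ (trans (any-map (λ y → ⌊≟⌋-≢ _≟_ (↑ˡ≢↑ʳ y d ∘ sym)) L) (any-false L))
                 (cong (_∨ false) (⌊≟⌋-injective _≟_ _≟_ (↑ʳ-injective n _ _) d c)) ⟩
  ⌊ d ≟ c ⌋ ∨ false
    ≡⟨ ∨-identityʳ _ ⟩
  ⌊ d ≟ c ⌋ ∎
  where open ≡-Reasoning

N≡double : ∀ k → N k ≡ double k
N≡double zero = refl
N≡double (suc k) = trans (ℕ.+-comm (N k) 2) (cong (λ n → suc (suc n)) (N≡double k))

toℕ-new : ∀ k c → toℕ (N k ↑ʳ c) ≡ pairNode k c
toℕ-new k c = trans (toℕ-↑ʳ (N k) c) (trans (ℕ.+-comm (N k) (toℕ c)) (cong (toℕ c +_) (N≡double k)))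

toℕ<double : ∀ {k} (x : Fin (N k)) → toℕ x < double k
toℕ<double {k} x = subst (toℕ x <_) (N≡double k) (toℕ<n x)

∈ᵇ-half : ∀ k c (x : Fin (N k)) → x ∈ᵇ half c (G k) ≡ ⌊ sideOf (toℕ x) ≟ c ⌋
∈ᵇ-half (suc k) c x with oldOrNew (N k) x
... | old y = begin
  (y ↑ˡ 2) ∈ᵇ half c (step (G k)) ≡⟨ cong ((y ↑ˡ 2) ∈ᵇ_) (half-step c (G k)) ⟩
  (y ↑ˡ 2) ∈ᵇ extend (half c (G k)) c ≡⟨ ∈ᵇ-extend-old y (half c (G k)) c ⟩
  y ∈ᵇ half c (G k) ≡⟨ ∈ᵇ-half k c y ⟩
  ⌊ sideOf (toℕ y) ≟ c ⌋ ≡⟨ cong (λ m → ⌊ sideOf m ≟ c ⌋) (sym (toℕ-↑ˡ y 2)) ⟩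
  ⌊ sideOf (toℕ (y ↑ˡ 2)) ≟ c ⌋ ∎
  where open ≡-Reasoning
... | new d = begin
  (N k ↑ʳ d) ∈ᵇ half c (step (G k)) ≡⟨ cong ((N k ↑ʳ d) ∈ᵇ_) (half-step c (G k)) ⟩
  (N k ↑ʳ d) ∈ᵇ extend (half c (G k)) c ≡⟨ ∈ᵇ-extend-new (half c (G k)) d c ⟩
  ⌊ d ≟ c ⌋ ≡⟨ cong (λ e → ⌊ e ≟ c ⌋) (sym (trans (cong sideOf (toℕ-new k d)) (sideOf-pairNode k d))) ⟩
  ⌊ sideOf (toℕ (N k ↑ʳ d)) ≟ c ⌋ ∎
  where open ≡-Reasoning

half-head : ∀ k c → ∃[ x ] ∃[ L ] half c (G (suc k)) ≡ x ∷ L × toℕ x ≡ toℕ c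
half-head zero zero = zero , [] , refl , refl
half-head zero (suc zero) = suc zero , [] , refl , refl
half-head (suc k) c with half-head k c
... | x , L , eq , x≡c =
  x ↑ˡ 2 , extend L c , trans (half-step c (G (suc k))) (cong (λ L → extend L c) eq) , trans (toℕ-↑ˡ x 2) x≡c

isFirst-half : ∀ k c (x : Fin (N k)) → isFirst x (half c (G k)) ≡ (toℕ x ≡ᵇ toℕ c)
isFirst-half (suc k) c x with half-head k c
... | y , L , eq , y≡c = trans (cong (isFirst x) eq) (trans (⌊≟⌋-toℕ x y) (cong (toℕ x ≡ᵇ_) y≡c))

newLinks≡linked : ∀ k c (x : Fin (N k)) → x ∈ᵇ half c (G k) ∨ isFirst x (half (opposite c) (G k)) ≡ linked (toℕ x) (pairNode k c)
newLinks≡linked k c x =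
  trans (cong₂ _∨_ (∈ᵇ-half k c x) (isFirst-half k (opposite c) x)) (sym (linked-to-pairNode c (toℕ<double {k} x)))

adj-G≡linked : ∀ k (u v : Fin (N k)) → adj (G k) u v ≡ linked (toℕ u) (toℕ v)
adj-G≡linked (suc k) u v with oldOrNew (N k) u | oldOrNew (N k) v
... | old x | old y = begin
  adj (step (G k)) (x ↑ˡ 2) (y ↑ˡ 2) ≡⟨ adj-step-old (G k) x y ⟩
  adj (G k) x y ≡⟨ adj-G≡linked k x y ⟩
  linked (toℕ x) (toℕ y) ≡⟨ sym (cong₂ linked (toℕ-↑ˡ x 2) (toℕ-↑ˡ y 2)) ⟩
  linked (toℕ (x ↑ˡ 2)) (toℕ (y ↑ˡ 2)) ∎
  where open ≡-Reasoning
... | old x | new c = begin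
  adj (step (G k)) (x ↑ˡ 2) (N k ↑ʳ c) ≡⟨ adj-step-old-new (G k) x c ⟩
  _ ≡⟨ newLinks≡linked k c x ⟩
  linked (toℕ x) (pairNode k c) ≡⟨ sym (cong₂ linked (toℕ-↑ˡ x 2) (toℕ-new k c)) ⟩
  linked (toℕ (x ↑ˡ 2)) (toℕ (N k ↑ʳ c)) ∎
  where open ≡-Reasoning
... | new c | old x = begin
  adj (step (G k)) (N k ↑ʳ c) (x ↑ˡ 2) ≡⟨ adj-step-new-old (G k) c x ⟩
  _ ≡⟨ newLinks≡linked k c x ⟩
  linked (toℕ x) (pairNode k c) ≡⟨ linked-sym (toℕ x) (pairNode k c) ⟩
  linked (pairNode k c) (toℕ x) ≡⟨ sym (cong₂ linked (toℕ-new k c) (toℕ-↑ˡ x 2)) ⟩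
  linked (toℕ (N k ↑ʳ c)) (toℕ (x ↑ˡ 2)) ∎
  where open ≡-Reasoning
... | new c | new d = begin
  adj (step (G k)) (N k ↑ʳ c) (N k ↑ʳ d) ≡⟨ adj-step-new (G k) c d ⟩
  not ⌊ c ≟ d ⌋ ≡⟨ sym (linked-within-pair k c d) ⟩
  linked (pairNode k c) (pairNode k d) ≡⟨ sym (cong₂ linked (toℕ-new k c) (toℕ-new k d)) ⟩
  linked (toℕ (N k ↑ʳ c)) (toℕ (N k ↑ʳ d)) ∎
  where open ≡-Reasoning

N≡2* : ∀ k → N k ≡ 2 * k
N≡2* k = trans (N≡double k) (double≡2* k)

G-mono : (i j : ℕ) → i ≤ j →
         Σ (N i ≤ N j) (λ le → ∀ u v → adj (G i) u v ≡ true → adj (G j) (inject≤ u le) (inject≤ v le) ≡ true)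
G-mono i j i≤j = N≤ , λ u v uv → begin
  adj (G j) (inject≤ u N≤) (inject≤ v N≤) ≡⟨ adj-G≡linked j _ _ ⟩
  linked (toℕ (inject≤ u N≤)) (toℕ (inject≤ v N≤)) ≡⟨ cong₂ linked (toℕ-inject≤ u N≤) (toℕ-inject≤ v N≤) ⟩
  linked (toℕ u) (toℕ v) ≡⟨ sym (adj-G≡linked i u v) ⟩
  adj (G i) u v ≡⟨ uv ⟩
  true ∎
  where
  open ≡-Reasoning
  N≤ : N i ≤ N j
  N≤ = subst₂ _≤_ (sym (N≡2* i)) (sym (N≡2* j)) (ℕ.*-monoʳ-≤ 2 i≤j)

-- Robustness

indicator : ∀ {n} → Subset n → ℕ → ℕ
indicator [] m = 0
indicator (b ∷ S) zero = oneIf b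
indicator (b ∷ S) (suc m) = indicator S m

∣∣≡∑indicator : ∀ {n} (S : Subset n) → ∣ S ∣ ≡ ∑[ m < n ] indicator S m
∣∣≡∑indicator [] = refl
∣∣≡∑indicator (true ∷ S) = cong suc (∣∣≡∑indicator S)
∣∣≡∑indicator (false ∷ S) = ∣∣≡∑indicator S

indicator≡0⇒∉ : ∀ {n} (S : Subset n) (x : Fin n) → indicator S (toℕ x) ≡ 0 → x ∉ S
indicator≡0⇒∉ (true ∷ S) zero () here
indicator≡0⇒∉ (b ∷ S) (suc x) S[x]≡0 (there x∈S) = indicator≡0⇒∉ S x S[x]≡0 x∈S

PairFree : (ℕ → ℕ) → ℕ → Set
PairFree f i = ∀ c → f (pairNode i c) ≡ 0

pairFree-suc : ∀ {f i} → PairFree (λ m → f (2 + m)) i → PairFree f (suc i)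
pairFree-suc free zero = free zero
pairFree-suc free (suc zero) = free (suc zero)

pair+rest<1+k⇒rest<k : ∀ {a b r k} → 0 < a + b → a + (b + r) < suc k → r < k
pair+rest<1+k⇒rest<k {a} {b} {r} 0<a+b a+b+r<1+k =
  ℕ.≤-trans (ℕ.≤-trans (ℕ.+-monoˡ-≤ r 0<a+b) (ℕ.≤-reflexive (ℕ.+-assoc a b r))) (s≤s⁻¹ a+b+r<1+k)

pigeonhole : ∀ k (f : ℕ → ℕ) → ∑[ m < double k ] f m < k → ∃[ i ] i < k × PairFree f i
pigeonhole (suc k) f ∑<1+k with f 0 + f 1 ℕ.≟ 0
... | yes f0+f1≡0 = 0 , z<s , λ { zero → ℕ.m+n≡0⇒m≡0 (f 0) f0+f1≡0 ; (suc zero) → ℕ.m+n≡0⇒n≡0 (f 0) f0+f1≡0 }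
... | no f0+f1≢0
  with i , i<k , free ← pigeonhole k (λ m → f (2 + m)) (pair+rest<1+k⇒rest<k {f 0} {f 1} (ℕ.n≢0⇒n>0 f0+f1≢0) ∑<1+k)
  = suc i , s≤s i<k , pairFree-suc {f} {i} free

pair+rest≡1+k⇒rest<k : ∀ {a b r k} → 0 < a → 0 < b → a + (b + r) ≡ suc k → r < k
pair+rest≡1+k⇒rest<k {r = r} 0<a 0<b a+b+r≡1+k =
  s≤s⁻¹ (subst (suc (suc r) ≤_) a+b+r≡1+k (ℕ.+-mono-≤ 0<a (ℕ.+-monoˡ-≤ r 0<b)))

free-first-or-pair : ∀ k (f : ℕ → ℕ) → ∑[ m < double (suc k) ] f m ≡ suc k →
                     (Σ[ c ∈ Fin 2 ] f (toℕ c) ≡ 0) ⊎ (∃[ i ] i < suc k × PairFree f i)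
free-first-or-pair k f ∑≡1+k with f 0 ℕ.≟ 0 | f 1 ℕ.≟ 0
... | yes f0≡0 | _ = inj₁ (zero , f0≡0)
... | no _ | yes f1≡0 = inj₁ (suc zero , f1≡0)
... | no f0≢0 | no f1≢0
  with i , i<k , free ← pigeonhole k (λ m → f (2 + m))
                          (pair+rest≡1+k⇒rest<k {f 0} {f 1} (ℕ.n≢0⇒n>0 f0≢0) (ℕ.n≢0⇒n>0 f1≢0) ∑≡1+k)
  = inj₂ (suc i , s≤s i<k , pairFree-suc {f} {i} free)

module _ (k : ℕ) (S : Subset (N k)) where

  reach-via : ∀ {u w v} → linkable (toℕ u) (toℕ w) ≡ true → w ∉ S → Reach (G k) S w v → Reach (G k) S u v
  reach-via {u} {w} lk w∉S w⇝v with toℕ u ℕ.≟ toℕ w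
  ... | yes u≡w = subst (λ x → Reach (G k) S x _) (sym (toℕ-injective u≡w)) w⇝v
  ... | no u≢w = there (trans (adj-G≡linked k u w) (cong₂ (λ e l → not e ∧ l) (≡ᵇ-≢ u≢w) lk)) w∉S w⇝v

  free-node : ∀ {m} → m < double k → indicator S m ≡ 0 → Σ[ w ∈ Fin (N k) ] toℕ w ≡ m × w ∉ S
  free-node {m} m<2k free = w , toℕ-w , indicator≡0⇒∉ S w (trans (cong (indicator S) toℕ-w) free)
    where
    m<N : m < N k
    m<N = subst (m <_) (sym (N≡double k)) m<2k
    w = fromℕ< m<N
    toℕ-w = toℕ-fromℕ< m<N

  reach-via-first : ∀ {u v} c → toℕ c < double k → indicator S (toℕ c) ≡ 0 → v ∉ S → Reach (G k) S u v
  reach-via-first {u} {v} c c<2k free v∉S with free-node c<2k free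
  ... | h , h≡c , h∉S = reach-via (linkable-firstʳ (toℕ u) h<2) h∉S (reach-via (linkable-firstˡ (toℕ v) h<2) v∉S here)
    where
    h<2 : toℕ h < 2
    h<2 = subst (_< 2) (sym h≡c) (toℕ<n c)

  reach-via-pair : ∀ {u v} i → i < k → PairFree (indicator S) i → v ∉ S → Reach (G k) S u v
  reach-via-pair {u} {v} i i<k free v∉S
    with free-node (pairNode-< (sideOf (toℕ u)) i<k) (free _) | free-node (pairNode-< (sideOf (toℕ v)) i<k) (free _)
  ... | w₀ , w₀≡ , w₀∉S | w₁ , w₁≡ , w₁∉S =
    reach-via (linkable-sameSide {toℕ u} (sym (side w₀≡))) w₀∉S
      (reach-via (linkable-samePair {toℕ w₀} (trans (pair w₀≡) (sym (pair w₁≡)))) w₁∉S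
        (reach-via (linkable-sameSide {toℕ w₁} (side w₁≡)) v∉S here))
    where
    side : ∀ {w c} → toℕ w ≡ pairNode i c → sideOf (toℕ w) ≡ c
    side {c = c} w≡ = trans (cong sideOf w≡) (sideOf-pairNode i c)
    pair : ∀ {w c} → toℕ w ≡ pairNode i c → ⌊ toℕ w /2⌋ ≡ i
    pair {c = c} w≡ = trans (cong ⌊_/2⌋ w≡) (⌊pairNode/2⌋ i c)

N/2≡ : ∀ k → N k / 2 ≡ k
N/2≡ k = trans (cong (_/ 2) (trans (N≡2* k) (ℕ.*-comm 2 k))) (m*n/n≡m k 2)

G-robust : ∀ k → Robust (G (suc k)) (N (suc k) / 2)
G-robust k S ∣S∣≡N/2 u v _ v∉S with free-first-or-pair k (indicator S) ∑≡1+k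
  where
  ∑≡1+k : ∑[ m < double (suc k) ] indicator S m ≡ suc k
  ∑≡1+k = begin
    ∑< (double (suc k)) (indicator S) ≡⟨ cong (λ n → ∑< n (indicator S)) (sym (N≡double (suc k))) ⟩
    ∑< (N (suc k)) (indicator S) ≡⟨ sym (∣∣≡∑indicator S) ⟩
    ∣ S ∣ ≡⟨ ∣S∣≡N/2 ⟩
    N (suc k) / 2 ≡⟨ N/2≡ (suc k) ⟩
    suc k ∎
    where open ≡-Reasoning
... | inj₁ (c , free) = reach-via-first (suc k) S c (ℕ.<-≤-trans (toℕ<n c) (s≤s (s≤s z≤n))) free v∉S
... | inj₂ (i , i<k , free) = reach-via-pair (suc k) S i i<k free v∉S

-- Counting links

∑-side : ∀ k c → ∑[ m < double k ] oneIf ⌊ sideOf m ≟ c ⌋ ≡ k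
∑-side zero c = refl
∑-side (suc k) zero = cong suc (∑-side k zero)
∑-side (suc k) (suc zero) = cong suc (∑-side k (suc zero))

∑-≡ᵇ : ∀ n a → ∑[ m < n ] oneIf (m ≡ᵇ a) ≤ 1
∑-≡ᵇ zero a = z≤n
∑-≡ᵇ (suc n) zero = ℕ.≤-reflexive (cong suc (∑-zero n (λ _ _ → refl)))
∑-≡ᵇ (suc n) (suc a) = ∑-≡ᵇ n a

linkCount : ℕ → ℕ
linkCount n = ∑[ m < n ] ∑[ l < n ] oneIf (linked m l ∧ (m <ᵇ l))

backDegree : ℕ → ℕ
backDegree n = ∑[ m < n ] oneIf (linked m n)

-- does (u <? v) computes to toℕ u <ᵇ toℕ v.
L≡linkCount : ∀ k → L k ≡ linkCount (N k)
L≡linkCount k = sum-allFin _ _ λ u → sum-allFin _ _ λ v →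
  cong oneIf (cong₂ _∧_ (adj-G≡linked k u v) (isYes≗does (u <? v)))

linkCount-suc : ∀ n → linkCount (suc n) ≤ linkCount n + backDegree n
linkCount-suc n = begin
  linkCount (suc n)
    ≡⟨ ∑-cong (suc n) (λ m → ∑-snoc n (λ l → g m l)) ⟩
  ∑[ m < suc n ] (∑[ l < n ] g m l + g m n)
    ≡⟨ ∑-snoc n _ ⟩
  ∑[ m < n ] (∑[ l < n ] g m l + g m n) + (∑[ l < n ] g n l + g n n)
    ≡⟨ cong₂ _+_ (∑-+ n _ _) (cong₂ _+_ (∑-zero n (λ l l<n → later-zero (ℕ.<⇒≤ l<n))) (later-zero ℕ.≤-refl)) ⟩
  linkCount n + ∑[ m < n ] g m n + 0
    ≤⟨ ℕ.+-monoˡ-≤ 0 (ℕ.+-monoʳ-≤ (linkCount n) (∑-mono-≤ n (λ m _ → oneIf-∧ (linked m n) _))) ⟩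
  linkCount n + backDegree n + 0
    ≡⟨ ℕ.+-identityʳ _ ⟩
  linkCount n + backDegree n ∎
  where
  open ℕ.≤-Reasoning
  g : ℕ → ℕ → ℕ
  g m l = oneIf (linked m l ∧ (m <ᵇ l))
  later-zero : ∀ {l} → l ≤ n → g n l ≡ 0
  later-zero {l} l≤n rewrite dec-false (n ℕ.<? l) (ℕ.≤⇒≯ l≤n) | ∧-zeroʳ (linked n l) = refl

∑-linked-to-pairNode : ∀ k c → ∑[ m < double k ] oneIf (linked m (pairNode k c)) ≤ suc k
∑-linked-to-pairNode k c = begin
  ∑[ m < double k ] oneIf (linked m (pairNode k c))
    ≤⟨ ∑-mono-≤ (double k) (λ m m<2k →
         ℕ.≤-trans (ℕ.≤-reflexive (cong oneIf (linked-to-pairNode c m<2k))) (oneIf-∨ ⌊ sideOf m ≟ c ⌋ _)) ⟩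
  ∑[ m < double k ] (oneIf ⌊ sideOf m ≟ c ⌋ + oneIf (m ≡ᵇ toℕ (opposite c)))
    ≡⟨ ∑-+ (double k) _ _ ⟩
  ∑[ m < double k ] oneIf ⌊ sideOf m ≟ c ⌋ + ∑[ m < double k ] oneIf (m ≡ᵇ toℕ (opposite c))
    ≤⟨ ℕ.+-mono-≤ (ℕ.≤-reflexive (∑-side k c)) (∑-≡ᵇ (double k) _) ⟩
  k + 1
    ≡⟨ ℕ.+-comm k 1 ⟩
  suc k ∎
  where open ℕ.≤-Reasoning

backDegree-even : ∀ k → backDegree (double k) ≤ suc k
backDegree-even k = ∑-linked-to-pairNode k zero

backDegree-odd : ∀ k → backDegree (suc (double k)) ≤ suc (suc k)
backDegree-odd k = begin
  backDegree (suc (double k))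
    ≡⟨ ∑-snoc (double k) _ ⟩
  ∑[ m < double k ] oneIf (linked m (pairNode k (suc zero))) + oneIf (linked (double k) (suc (double k)))
    ≤⟨ ℕ.+-mono-≤ (∑-linked-to-pairNode k (suc zero)) (oneIf≤1 _) ⟩
  suc k + 1
    ≡⟨ ℕ.+-comm (suc k) 1 ⟩
  suc (suc k) ∎
  where open ℕ.≤-Reasoning

linkCount-bound : ∀ k → linkCount (double (suc k)) ≤ suc k * suc k + double k
linkCount-bound zero = ℕ.≤-refl
linkCount-bound (suc k) = begin
  linkCount (suc (suc d))
    ≤⟨ linkCount-suc (suc d) ⟩
  linkCount (suc d) + backDegree (suc d)
    ≤⟨ ℕ.+-monoˡ-≤ _ (linkCount-suc d) ⟩
  linkCount d + backDegree d + backDegree (suc d)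
    ≤⟨ ℕ.+-mono-≤ (ℕ.+-mono-≤ (linkCount-bound k) (backDegree-even (suc k))) (backDegree-odd (suc k)) ⟩
  suc k * suc k + double k + suc (suc k) + suc (suc (suc k))
    ≡⟨ square-step k (double k) ⟩
  suc (suc k) * suc (suc k) + double (suc k) ∎
  where
  open ℕ.≤-Reasoning
  d = double (suc k)
  square-step : ∀ k d → suc k * suc k + d + suc (suc k) + suc (suc (suc k)) ≡ suc (suc k) * suc (suc k) + suc (suc d)
  square-step = solve-∀

double*double/4≡* : ∀ n → double n * double n / 4 ≡ n * n
double*double/4≡* n = begin
  double n * double n / 4 ≡⟨ cong (λ m → m * m / 4) (double≡2* n) ⟩
  2 * n * (2 * n) / 4 ≡⟨ cong (_/ 4) (square-double n) ⟩
  n * n * 4 / 4 ≡⟨ m*n/n≡m (n * n) 4 ⟩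
  n * n ∎
  where
  open ≡-Reasoning
  square-double : ∀ n → 2 * n * (2 * n) ≡ n * n * 4
  square-double = solve-∀

L-bound : ∀ k → L (suc k) ≤ N (suc k) * N (suc k) / 4 + N (suc k) ∸ 2
L-bound k = begin
  L (suc k) ≡⟨ L≡linkCount (suc k) ⟩
  linkCount (N (suc k)) ≡⟨ cong linkCount (N≡double (suc k)) ⟩
  linkCount (double (suc k)) ≤⟨ linkCount-bound k ⟩
  suc k * suc k + double k ≡⟨ sym (ℕ.+-∸-assoc (suc k * suc k) {suc (suc (double k))} (s≤s (s≤s z≤n))) ⟩
  suc k * suc k + double (suc k) ∸ 2 ≡⟨ cong (λ q → q + double (suc k) ∸ 2) (sym (double*double/4≡* (suc k))) ⟩
  double (suc k) * double (suc k) / 4 + double (suc k) ∸ 2 ≡⟨ cong (λ n → n * n / 4 + n ∸ 2) (sym (N≡double (suc k))) ⟩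
  N (suc k) * N (suc k) / 4 + N (suc k) ∸ 2 ∎
  where open ℕ.≤-Reasoning

theorem9 : ((i j : ℕ) → i ≤ j →
             Σ (N i ≤ N j) (λ le → ∀ u v → adj (G i) u v ≡ true →
               adj (G j) (inject≤ u le) (inject≤ v le) ≡ true))
           × ((k : ℕ) → N k ≡ 2 * k)
           × ((k : ℕ) → 1 ≤ k → Robust (G k) (N k / 2) × L k ≤ N k * N k / 4 + N k ∸ 2)
theorem9 = G-mono , N≡2* , robust-and-bounded
  where
  robust-and-bounded : (k : ℕ) → 1 ≤ k → Robust (G k) (N k / 2) × L k ≤ N k * N k / 4 + N k ∸ 2
  robust-and-bounded (suc k) _ = G-robust k , L-bound k
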